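{- Let $d\ge 1$ and $n\ge 1$. A $d$-permutation $P$ of $[n]$ is separable if and only if it avoids each of the patterns $$\pi_1=\begin{pmatrix}1&2&3&4\\2&4&1&3\end{pmatrix},\quad \pi_2=\begin{pmatrix}1&2&3\\2&1&3\\1&3&2\end{pmatrix},\quad \pi_3=\begin{pmatrix}1&2&3\\2&3&1\\3&1&2\end{pmatrix}.$$
   Context: A $d$-permutation of $[n]=\{1,\dots,n\}$ is a $d\times n$ matrix $P$ each row of which is a permutation of $[n]$, the first row being $1\,2\cdots n$; $P_{ij}$ denotes its $(i,j)$ entry. A $d$-permutation $P$ of $[n]$ is separable if either $n=1$, or $n>1$ and there is $\ell$ with $1\le \ell<n$ such that (a) for each row $i$, either $P_{ij_1}<P_{ij_2}$ for all $1\le j_1\le \ell<j_2\le n$, or $P_{ij_1}>P_{ij_2}$ for all $1\le j_1\le \ell<j_2\le n$; and (b) the two $d$-permutations obtained from the first $\ell$ columns and from the last $n-\ell$ columns of $P$, after order-preserving relabeling of each row to $[\ell]$, resp. $[n-\ell]$, are themselves separable. Pattern containment: for a $d'$-permutation $Q$ of $[n']$, $P$ contains $Q$ if there are pairwise distinct row indices $i_1,\dots,i_{d'}$ of $P$ (taken in any order) and $n'$ distinct columns of $P$ such that the $d'\times n'$ matrix whose $t$-th row is the restriction of row $i_t$ of $P$ to these columns, after relabeling each row order-preservingly so that its entries are $[n']$ and then permuting the columns so that the first row becomes $1\,2\cdots n'$, equals $Q$. Thus patterns are considered up to permuting their rows (followed by re-sorting columns so that the first row is increasing). $P$ avoids $Q$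 if it does not contain $Q$. -}

module Defs where

open import Data.Nat using (ℕ; zero; suc; _+_; _<ᵇ_)
import Data.Nat as N
open import Data.Bool using (if_then_else_)
open import Data.Fin using (Fin; toℕ; _↑ˡ_; _↑ʳ_)
import Data.Fin as F
open import Data.Fin.Permutation using (Permutation′; _⟨$⟩ʳ_)
open import Data.Vec using (Vec; []; _∷_; lookup)
open import Data.Product using (Σ; ∃; _×_; _,_)
open import Data.Sum using (_⊎_)
open import Relation.Nullary using (¬_)
open import Relation.Binary.PropositionalEquality using (_≡_)
open import Function.Definitions using (Injective)

-- A d × n matrix with natural-number entries; entry (i , j) is  M i j.
-- Rows and columns are 0-indexed; permutations of [n] are encoded 0-based,
-- i.e. as permutations of {0, …, n-1}.
Mat : ℕ → ℕ → Set
Mat d n = Fin d → Fin n → ℕ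

record IsDPerm {d n : ℕ} (P : Mat d n) : Set where
  field
    bounded  : ∀ i j → P i j N.< n
    rowInj   : ∀ i → Injective _≡_ _≡_ (P i)
    firstRow : ∀ (i : Fin d) → toℕ i ≡ 0 → ∀ j → P i j ≡ toℕ j

countBelow : {m : ℕ} → (Fin m → ℕ) → ℕ → ℕ
countBelow {zero}  f x = 0
countBelow {suc m} f x =
  (if f F.zero <ᵇ x then 1 else 0) + countBelow (λ k → f (F.suc k)) x

-- order-preserving relabelling of each row (to {0,…,m-1} when the row is injective)
relabel : {d m : ℕ} → Mat d m → Mat d m
relabel M i j = countBelow (M i) (M i j)

leftPart : {d l r : ℕ} → Mat d (suc l + suc r) → Mat d (suc l)
leftPart {r = r} M i j = M i (j ↑ˡ suc r)

rightPart : {d l r : ℕ} → Mat d (suc l + suc r) → Mat d (suc r)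
rightPart {l = l} M i j = M i (suc l ↑ʳ j)

SplitOK : {d l r : ℕ} → Mat d (suc l + suc r) → Set
SplitOK {d} {l} {r} M = ∀ (i : Fin d) →
    (∀ (j₁ : Fin (suc l)) (j₂ : Fin (suc r)) → leftPart M i j₁ N.< rightPart M i j₂)
  ⊎ (∀ (j₁ : Fin (suc l)) (j₂ : Fin (suc r)) → leftPart M i j₁ N.> rightPart M i j₂)

-- separability (recursive definition of the paper; ℓ = suc l, n - ℓ = suc r)
data Separable {d : ℕ} : (n : ℕ) → Mat d n → Set where
  sep-one   : (M : Mat d 1) → Separable 1 M
  sep-split : {l r : ℕ} (M : Mat d (suc l + suc r)) →
              SplitOK M →
              Separable (suc l) (relabel (leftPart M)) →
              Separable (suc r) (relabel (rightPart M)) →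
              Separable (suc l + suc r) M

-- pattern containment: pairwise distinct rows ι (in any order), a set of n'
-- columns given increasingly by c, restricted, relabelled, then columns
-- permuted by σ, giving Q.
Contains : {d n d' n' : ℕ} → Mat d n → Mat d' n' → Set
Contains {d} {n} {d'} {n'} P Q =
  Σ (Fin d' → Fin d) λ ι → Injective _≡_ _≡_ ι ×
  Σ (Fin n' → Fin n) λ c → (∀ {a b} → a F.< b → c a F.< c b) ×
  Σ (Permutation′ n') λ σ →
    ∀ t k → relabel (λ t′ k′ → P (ι t′) (c k′)) t (σ ⟨$⟩ʳ k) ≡ Q t k

Avoids : {d n d' n' : ℕ} → Mat d n → Mat d' n' → Set
Avoids P Q = ¬ Contains P Q

fromRows : {d n : ℕ} → Vec (Vec ℕ n) d → Mat d n
fromRows rows i j = lookup (lookup rows i) j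

-- the three patterns (0-based entries)
π₁ : Mat 2 4
π₁ = fromRows ((0 ∷ 1 ∷ 2 ∷ 3 ∷ []) ∷ (1 ∷ 3 ∷ 0 ∷ 2 ∷ []) ∷ [])

π₂ : Mat 3 3
π₂ = fromRows ((0 ∷ 1 ∷ 2 ∷ []) ∷ (1 ∷ 0 ∷ 2 ∷ []) ∷ (0 ∷ 2 ∷ 1 ∷ []) ∷ [])

π₃ : Mat 3 3
π₃ = fromRows ((0 ∷ 1 ∷ 2 ∷ []) ∷ (1 ∷ 2 ∷ 0 ∷ []) ∷ (2 ∷ 0 ∷ 1 ∷ []) ∷ [])

-- A separable matrix avoids π₁, π₂ and π₃ because these patterns are indecomposable: no
-- split of their columns into two nonempty blocks is respected by every row.  Hence an
-- occurrence inside a separable matrix can never straddle a split, and it would survive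
-- down to a single column.
--
-- Conversely, let the rows be injective and suppose none of the patterns occurs; it is
-- enough to find a position that cuts every row, and then recurse on both blocks.  The first N columns have a least cut m.  If neither m
-- nor N cuts the whole matrix, then the last column is misplaced with respect to the first
-- m columns in some row and lies strictly inside the values of another row.  Minimality
-- of m makes the row inversions among the first m columns connect them, and following an
-- inversion towards the last column produces either three columns that two rows "centre"
-- differently, or a row carrying 2413 or 3142 on four columns.  Read against the
-- increasing first row, these are occurrences of π₂ or π₃, respectively of π₁.
module Submission where

open import Defs
open import Data.Bool using (Bool; true; false; if_then_else_)
import Data.Bool.Properties as Bool
open import Data.Empty using (⊥)
open import Data.Fin using (Fin; toℕ; splitAt; _↑ˡ_; _↑ʳ_; inject₁; fromℕ; fromℕ<; lower₁)
import Data.Fin as F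
open import Data.Fin.Patterns using (0F; 1F; 2F; 3F)
open import Data.Fin.Permutation using (Permutation′; _⟨$⟩ʳ_; _⟨$⟩ˡ_; inverseˡ; permutation; transpose)
import Data.Fin.Permutation as Perm
open import Data.Fin.Properties
  using ( all?; any?; ¬∀⟶∃¬; splitAt⁻¹-↑ˡ; splitAt⁻¹-↑ʳ; toℕ-injective; toℕ<n; toℕ-↑ˡ; toℕ-↑ʳ
        ; ↑ˡ-injective; ↑ʳ-injective; toℕ-inject₁; inject₁-injective; inject₁-lower₁
        ; inject₁ℕ<; toℕ-fromℕ; toℕ-fromℕ< )
open import Data.Fin.Subset using (Subset)
open import Data.Fin.Subset.Properties using (anySubset?)
open import Data.Nat using (ℕ; zero; suc; _+_; _∸_; _<ᵇ_; _≤_; _<_; z≤n; s≤s; s≤s⁻¹; z<s; s<s)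
open import Data.Nat.Induction using (<-rec)
open import Data.Nat.Properties
open import Data.Product using (Σ; ∃; ∃₂; ∃-syntax; _×_; _,_; proj₁; proj₂)
open import Data.Sum using (_⊎_; inj₁; inj₂; [_,_]′; swap)
open import Data.Vec using (Vec; []; _∷_; lookup; tabulate)
open import Data.Vec.Properties using (lookup∘tabulate)
open import Function.Base using (_∘_; const; id)
open import Function.Bundles using (_⇔_; mk⇔)
open import Function.Definitions using (Injective)
open import Relation.Binary using (tri<; tri≈; tri>)
open import Relation.Binary.PropositionalEquality
  using (_≡_; _≢_; refl; sym; trans; cong; cong₂; subst; subst₂; module ≡-Reasoning)
open import Relation.Nullary using (¬_; contradiction; Dec; yes; no; ¬?)
open import Relation.Nullary.Decidable
  using (map′; _×-dec_; _⊎-dec_; _→-dec_; decidable-stable; from-yes; True; toWitness)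
open import Relation.Nullary.Reflects using (ofʸ; ofⁿ)
open import Relation.Unary using (Decidable)

OrderPreserving : ∀ {n} → (Fin n → ℕ) → (Fin n → ℕ) → Set
OrderPreserving f g = ∀ {a b} → f a < f b → g a < g b

OrderPreserving-reflects : ∀ {n} {f g : Fin n → ℕ} → OrderPreserving f g →
  Injective _≡_ _≡_ f → ∀ {a b} → g a < g b → f a < f b
OrderPreserving-reflects {f = f} f⇒g f-inj {a} {b} ga<gb with <-cmp (f a) (f b)
... | tri< fa<fb _ _ = fa<fb
... | tri≈ _ fa≡fb _ = contradiction ga<gb (<-irrefl (cong _ (f-inj fa≡fb)))
... | tri> _ _ fb<fa = contradiction ga<gb (<-asym (f⇒g fb<fa))

RowInjective : ∀ {d n} → Mat d n → Set
RowInjective M = ∀ i → Injective _≡_ _≡_ (M i)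

rowInjective? : ∀ {d n} (M : Mat d n) → Dec (RowInjective M)
rowInjective? M = map′ (λ inj i {a} {b} → inj i a b) (λ inj i a b → inj i)
  (all? λ i → all? λ a → all? λ b → (M i a ≟ M i b) →-dec (a F.≟ b))

isBelow : ℕ → ℕ → ℕ
isBelow a x = if a <ᵇ x then 1 else 0

isBelow-cong : ∀ {a x b y} → (a < x → b < y) → (b < y → a < x) → isBelow a x ≡ isBelow b y
isBelow-cong {a} {x} {b} {y} a<x⇒b<y b<y⇒a<x
  with a <ᵇ x | <ᵇ-reflects-< a x | b <ᵇ y | <ᵇ-reflects-< b y
... | true  | _       | true  | _       = refl
... | false | _       | false | _       = refl
... | true  | ofʸ a<x | false | ofⁿ b≮y = contradiction (a<x⇒b<y a<x) b≮y
... | false | ofⁿ a≮x | true  | ofʸ b<y = contradiction (b<y⇒a<x b<y) a≮x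

isBelow-mono : ∀ a {x y} → x ≤ y → isBelow a x ≤ isBelow a y
isBelow-mono a {x} {y} x≤y with a <ᵇ x | <ᵇ-reflects-< a x | a <ᵇ y | <ᵇ-reflects-< a y
... | false | _       | _     | _       = z≤n
... | true  | _       | true  | _       = ≤-refl
... | true  | ofʸ a<x | false | ofⁿ a≮y = contradiction (<-≤-trans a<x x≤y) a≮y

isBelow-self : ∀ a → isBelow a a ≡ 0
isBelow-self a with a <ᵇ a | <ᵇ-reflects-< a a
... | false | _       = refl
... | true  | ofʸ a<a = contradiction a<a (<-irrefl refl)

isBelow-< : ∀ {a x} → a < x → isBelow a x ≡ 1
isBelow-< {a} {x} a<x with a <ᵇ x | <ᵇ-reflects-< a x
... | true  | _       = refl
... | false | ofⁿ a≮x = contradiction a<x a≮x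

countBelow-mono : ∀ {m} (f : Fin m → ℕ) {x y} → x ≤ y → countBelow f x ≤ countBelow f y
countBelow-mono {zero}  f x≤y = z≤n
countBelow-mono {suc m} f x≤y =
  +-mono-≤ (isBelow-mono (f F.zero) x≤y) (countBelow-mono (f ∘ F.suc) x≤y)

countBelow-strict : ∀ {m} (f : Fin m → ℕ) j {y} → f j < y → countBelow f (f j) < countBelow f y
countBelow-strict f F.zero fj<y rewrite isBelow-self (f F.zero) | isBelow-< fj<y =
  s≤s (countBelow-mono (f ∘ F.suc) (<⇒≤ fj<y))
countBelow-strict f (F.suc j) fj<y =
  +-mono-≤-< (isBelow-mono (f F.zero) (<⇒≤ fj<y)) (countBelow-strict (f ∘ F.suc) j fj<y)

countBelow-cong : ∀ {m} (f g : Fin m → ℕ) {x y} →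
  (∀ j → f j < x → g j < y) → (∀ j → g j < y → f j < x) → countBelow f x ≡ countBelow g y
countBelow-cong {zero}  f g f⇒g g⇒f = refl
countBelow-cong {suc m} f g f⇒g g⇒f =
  cong₂ _+_ (isBelow-cong (f⇒g F.zero) (g⇒f F.zero))
            (countBelow-cong (f ∘ F.suc) (g ∘ F.suc) (f⇒g ∘ F.suc) (g⇒f ∘ F.suc))

relabel-mono-< : ∀ {d m} (M : Mat d m) i → OrderPreserving (M i) (relabel M i)
relabel-mono-< M i {a} = countBelow-strict (M i) a

relabel-cancel-< : ∀ {d m} (M : Mat d m) i → OrderPreserving (relabel M i) (M i)
relabel-cancel-< M i {a} {b} ra<rb with <-cmp (M i a) (M i b)
... | tri< a<b _ _ = a<b
... | tri≈ _ a≡b _ = contradiction ra<rb (<-irrefl (cong (countBelow (M i)) a≡b))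
... | tri> _ _ b<a = contradiction ra<rb (<-asym (relabel-mono-< M i b<a))

relabel-injective : ∀ {d m} {M : Mat d m} → RowInjective M → RowInjective (relabel M)
relabel-injective {M = M} inj i {a} {b} ra≡rb with <-cmp (M i a) (M i b)
... | tri< a<b _ _ = contradiction ra≡rb (<⇒≢ (relabel-mono-< M i a<b))
... | tri≈ _ a≡b _ = inj i a≡b
... | tri> _ _ b<a = contradiction (sym ra≡rb) (<⇒≢ (relabel-mono-< M i b<a))

data Orientation : Set where
  ascending descending : Orientation

reverse : Orientation → Orientation
reverse ascending  = descending
reverse descending = ascending

_<[_]_ : ℕ → Orientation → ℕ → Set
x <[ ascending  ] y = x < y
x <[ descending ] y = y < x

_<[_]?_ : ∀ x o y → Dec (x <[ o ] y)
x <[ ascending  ]? y = x <? y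
x <[ descending ]? y = y <? x

<[]-trans : ∀ o {x y z} → x <[ o ] y → y <[ o ] z → x <[ o ] z
<[]-trans ascending  x<y y<z = <-trans x<y y<z
<[]-trans descending y<x z<y = <-trans z<y y<x

<[]-asym : ∀ o {x y} → x <[ o ] y → ¬ y <[ o ] x
<[]-asym ascending  = <-asym
<[]-asym descending = <-asym

<[]-connex : ∀ o {x y} → x ≢ y → x <[ o ] y ⊎ y <[ o ] x
<[]-connex ascending  {x} {y} x≢y with <-cmp x y
... | tri< x<y _ _ = inj₁ x<y
... | tri≈ _ x≡y _ = contradiction x≡y x≢y
... | tri> _ _ y<x = inj₂ y<x
<[]-connex descending x≢y = swap (<[]-connex ascending x≢y)

<[]-reverse : ∀ o {x y} → x <[ reverse o ] y → y <[ o ] x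
<[]-reverse ascending  y<x = y<x
<[]-reverse descending x<y = x<y

∃-orientation? : {P : Orientation → Set} → (∀ o → Dec (P o)) → Dec (∃ P)
∃-orientation? P? =
  map′ [ (ascending ,_) , (descending ,_) ]′ byCases (P? ascending ⊎-dec P? descending)
  where
  byCases : ∀ {P : Orientation → Set} → ∃ P → P ascending ⊎ P descending
  byCases (ascending  , p) = inj₁ p
  byCases (descending , p) = inj₂ p

OrderPreserving-<[] : ∀ {n} {f g : Fin n → ℕ} → OrderPreserving f g →
  ∀ o {a b} → f a <[ o ] f b → g a <[ o ] g b
OrderPreserving-<[] f⇒g ascending  = f⇒g
OrderPreserving-<[] f⇒g descending = f⇒g

OrderPreserving-reflects-<[] : ∀ {n} {f g : Fin n → ℕ} → OrderPreserving f g → Injective _≡_ _≡_ f →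
  ∀ o {a b} → g a <[ o ] g b → f a <[ o ] f b
OrderPreserving-reflects-<[] f⇒g f-inj ascending  = OrderPreserving-reflects f⇒g f-inj
OrderPreserving-reflects-<[] f⇒g f-inj descending = OrderPreserving-reflects f⇒g f-inj

-- Separable matrices avoid indecomposable patterns

Separates : ∀ {n} → Subset n → (Fin n → ℕ) → Set
Separates s f = ∃[ o ] ∀ a b → lookup s a ≡ true → lookup s b ≡ false → f a <[ o ] f b

Monochromatic : ∀ {n} → Subset n → Set
Monochromatic s = (∀ a → lookup s a ≡ true) ⊎ (∀ a → lookup s a ≡ false)

Indecomposable : ∀ {d n} → Mat d n → Set
Indecomposable Q = ∀ s → (∀ t → Separates s (Q t)) → Monochromatic s

separates? : ∀ {n} s (f : Fin n → ℕ) → Dec (Separates s f)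
separates? s f = ∃-orientation? λ o → all? λ a → all? λ b →
  (lookup s a Bool.≟ true) →-dec ((lookup s b Bool.≟ false) →-dec (f a <[ o ]? f b))

monochromatic? : ∀ {n} (s : Subset n) → Dec (Monochromatic s)
monochromatic? s = all? (λ a → lookup s a Bool.≟ true) ⊎-dec all? (λ a → lookup s a Bool.≟ false)

indecomposable? : ∀ {d n} (Q : Mat d n) → Dec (Indecomposable Q)
indecomposable? Q
  with anySubset? (λ s → all? (λ t → separates? s (Q t)) ×-dec ¬? (monochromatic? s))
... | yes (s , separated , ¬mono) = no λ indecomposable → ¬mono (indecomposable s separated)
... | no ¬split = yes λ s separated →
  decidable-stable (monochromatic? s) (λ ¬mono → ¬split (s , separated , ¬mono))

π₁-indecomposable : Indecomposable π₁
π₁-indecomposable = from-yes (indecomposable? π₁)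

π₂-indecomposable : Indecomposable π₂
π₂-indecomposable = from-yes (indecomposable? π₂)

π₃-indecomposable : Indecomposable π₃
π₃-indecomposable = from-yes (indecomposable? π₃)

Embeds : ∀ {d' n' d n} → Mat d' n' → Mat d n → Set
Embeds {d'} {n'} {d} {n} Q M = Σ (Fin d' → Fin d) λ ι → Σ (Fin n' → Fin n) λ e →
  ∀ t → OrderPreserving (Q t) (λ k → M (ι t) (e k))

contains⇒embeds : ∀ {d n d' n'} (P : Mat d n) (Q : Mat d' n') → Contains P Q → Embeds Q P
contains⇒embeds P Q (ι , _ , c , _ , σ , relabelled) = ι , (λ k → c (σ ⟨$⟩ʳ k)) ,
  λ t {a} {b} Qa<Qb →
    relabel-cancel-< (λ t′ k′ → P (ι t′) (c k′)) t
      (subst₂ _<_ (sym (relabelled t a)) (sym (relabelled t b)) Qa<Qb)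

embeds-in-block : ∀ {d' n' d n m} {Q : Mat d' n'} {M : Mat d n} (f : Fin m → Fin n) →
  (ι : Fin d' → Fin d) (e : Fin n' → Fin n) → (∀ t → OrderPreserving (Q t) (λ k → M (ι t) (e k))) →
  (∀ k → ∃[ j ] f j ≡ e k) → Embeds Q (relabel (λ i j → M i (f j)))
embeds-in-block {M = M} f ι e preserves index = ι , proj₁ ∘ index , λ t Qa<Qb →
  relabel-mono-< (λ i j → M i (f j)) (ι t)
    (subst₂ _<_ (cong (M (ι t)) (sym (proj₂ (index _)))) (cong (M (ι t)) (sym (proj₂ (index _))))
                (preserves t Qa<Qb))

splitOK-oriented : ∀ {d l r} {M : Mat d (suc l + suc r)} → SplitOK M →
  ∀ i → ∃[ o ] ∀ j₁ j₂ → leftPart M i j₁ <[ o ] rightPart M i j₂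
splitOK-oriented split i with split i
... | inj₁ below = ascending  , below
... | inj₂ above = descending , above

module _ {l r : ℕ} where

  inLeft : Fin (suc l + suc r) → Bool
  inLeft x = [ const true , const false ]′ (splitAt (suc l) x)

  leftIndex : ∀ x → inLeft x ≡ true → ∃[ j ] j ↑ˡ suc r ≡ x
  leftIndex x _ with splitAt (suc l) x in eq
  leftIndex x _  | inj₁ j = j , splitAt⁻¹-↑ˡ eq
  leftIndex x () | inj₂ j

  rightIndex : ∀ x → inLeft x ≡ false → ∃[ j ] suc l ↑ʳ j ≡ x
  rightIndex x _ with splitAt (suc l) x in eq
  rightIndex x () | inj₁ j
  rightIndex x _  | inj₂ j = j , splitAt⁻¹-↑ʳ eq

module _ {d' k} (Q : Mat (suc d') (suc (suc k))) (Q-injective : RowInjective Q)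
         (Q-indecomposable : Indecomposable Q) where

  separable⇒¬embeds : ∀ {d n} {M : Mat d n} → Separable n M → ¬ Embeds Q M
  separable⇒¬embeds (sep-one M) (ι , e , preserves) =
    [ collapse 0F 1F , collapse 1F 0F ]′
      (<[]-connex ascending {Q 0F 0F} {Q 0F 1F} (λ q₀≡q₁ → contradiction (Q-injective 0F q₀≡q₁) λ ()))
    where
    sameColumn : (a b : Fin 1) → a ≡ b
    sameColumn 0F 0F = refl
    collapse : ∀ a b → Q 0F a < Q 0F b → ⊥
    collapse a b Qa<Qb = <-irrefl (cong (M (ι 0F)) (sameColumn (e a) (e b))) (preserves 0F Qa<Qb)
  separable⇒¬embeds (sep-split {l} {r} M split separableˡ separableʳ) (ι , e , preserves) =
    [ (λ allLeft → separable⇒¬embeds separableˡ (embeds-in-block {M = M} (_↑ˡ suc r) ι e preserves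
                       λ k → leftIndex (e k) (trans (sym (side k)) (allLeft k))))
    , (λ allRight → separable⇒¬embeds separableʳ (embeds-in-block {M = M} (suc l ↑ʳ_) ι e preserves
                       λ k → rightIndex (e k) (trans (sym (side k)) (allRight k))))
    ]′ (Q-indecomposable sides patternSeparates)
    where
    sides : Subset (suc (suc k))
    sides = tabulate (inLeft ∘ e)
    side : ∀ k → lookup sides k ≡ inLeft (e k)
    side = lookup∘tabulate (inLeft ∘ e)
    patternSeparates : ∀ t → Separates sides (Q t)
    patternSeparates t with splitOK-oriented {M = M} split (ι t)
    ... | o , crosses = o , λ a b a-left b-right →
      let (ja , ja↑≡ea) = leftIndex (e a) (trans (sym (side a)) a-left)
          (jb , jb↑≡eb) = rightIndex (e b) (trans (sym (side b)) b-right)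
      in OrderPreserving-reflects-<[] (preserves t) (Q-injective t) o
           (subst₂ (_<[ o ]_) (cong (M (ι t)) ja↑≡ea) (cong (M (ι t)) jb↑≡eb) (crosses ja jb))

separable⇒avoids : ∀ {d' k d n} (Q : Mat (suc d') (suc (suc k))) →
  {injective : True (rowInjective? Q)} → Indecomposable Q → {P : Mat d n} → Separable n P → Avoids P Q
separable⇒avoids Q {injective} indecomposable {P} separable =
  separable⇒¬embeds Q (toWitness injective) indecomposable separable ∘ contains⇒embeds P Q

-- Cuts and obstructions

Crosses : ∀ {d n} → Mat d n → Fin d → ℕ → Orientation → Fin n → Fin n → Set
Crosses M i ℓ o j j' = toℕ j < ℓ → ℓ ≤ toℕ j' → M i j <[ o ] M i j'

crosses? : ∀ {d n} (M : Mat d n) i ℓ o j j' → Dec (Crosses M i ℓ o j j')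
crosses? M i ℓ o j j' = (toℕ j <? ℓ) →-dec ((ℓ ≤? toℕ j') →-dec (M i j <[ o ]? M i j'))

RowCut : ∀ {d n} → Mat d n → Fin d → ℕ → Orientation → Set
RowCut M i ℓ o = ∀ j j' → Crosses M i ℓ o j j'

CutAt : ∀ {d n} → Mat d n → ℕ → Set
CutAt M ℓ = ∀ i → ∃ (RowCut M i ℓ)

ProperCut : ∀ {d n} → Mat d n → Set
ProperCut {n = n} M = ∃[ ℓ ] 1 ≤ ℓ × ℓ < n × CutAt M ℓ

rowCut? : ∀ {d n} (M : Mat d n) i ℓ o → Dec (RowCut M i ℓ o)
rowCut? M i ℓ o = all? λ j → all? (crosses? M i ℓ o j)

cutAt? : ∀ {d n} (M : Mat d n) ℓ → Dec (CutAt M ℓ)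
cutAt? M ℓ = all? λ i → ∃-orientation? (rowCut? M i ℓ)

-- Opaque because `with` on these lemmas would otherwise unfold the decision procedures.
opaque
  ¬cutAt⇒¬rowCut : ∀ {d n} {M : Mat d n} {ℓ} → ¬ CutAt M ℓ → ∃[ i ] ∀ o → ¬ RowCut M i ℓ o
  ¬cutAt⇒¬rowCut {d} {M = M} {ℓ} ¬cut with ¬∀⟶∃¬ d _ (λ i → ∃-orientation? (rowCut? M i ℓ)) ¬cut
  ... | i , ¬rowCut = i , λ o rowCut → ¬rowCut (o , rowCut)

  ¬rowCut⇒inversion : ∀ {d n} {M : Mat d n} → RowInjective M → ∀ {i ℓ o} → ¬ RowCut M i ℓ o →
    ∃₂ λ j j' → toℕ j < ℓ × ℓ ≤ toℕ j' × M i j' <[ o ] M i j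
  ¬rowCut⇒inversion {n = n} {M} inj {i} {ℓ} {o} ¬rowCut
    with ¬∀⟶∃¬ n _ (λ j → all? (crosses? M i ℓ o j)) ¬rowCut
  ... | j , ¬∀j' with ¬∀⟶∃¬ n _ (crosses? M i ℓ o j) ¬∀j'
  ... | j' , ¬crosses with toℕ j <? ℓ | ℓ ≤? toℕ j'
  ... | no j≮ℓ  | _        = contradiction (λ j<ℓ → contradiction j<ℓ j≮ℓ) ¬crosses
  ... | yes _   | no ℓ≰j'  = contradiction (λ _ ℓ≤j' → contradiction ℓ≤j' ℓ≰j') ¬crosses
  ... | yes j<ℓ | yes ℓ≤j'
    with <[]-connex o (λ eq → <-irrefl (cong toℕ (inj i eq)) (<-≤-trans j<ℓ ℓ≤j'))
  ...   | inj₁ j<j' = contradiction (λ _ _ → j<j') ¬crosses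
  ...   | inj₂ j'<j = j , j' , j<ℓ , ℓ≤j' , j'<j

Between : ℕ → ℕ → ℕ → Set
Between x y w = (x < y × y < w) ⊎ (w < y × y < x)

Between-sym : ∀ {x y w} → Between x y w → Between w y x
Between-sym (inj₁ xyw) = inj₂ xyw
Between-sym (inj₂ wyx) = inj₁ wyx

between : ∀ o {x y w} → x <[ o ] y → y <[ o ] w → Between x y w
between ascending  x<y y<w = inj₁ (x<y , y<w)
between descending y<x w<y = inj₂ (w<y , y<x)

record Obstruction₃ {d n} (M : Mat d n) : Set where
  constructor obstruction₃
  field
    p q z : Fin n
    p<q : p F.< q
    q<z : q F.< z
    α β : Fin d
    α-between : Between (M α q) (M α p) (M α z)
    β-between : Between (M β p) (M β z) (M β q)

-- Row γ reads 3142 (ascending) or 2413 (descending) on the columns a < b < c < e.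
record Obstruction₄ {d n} (M : Mat d n) : Set where
  constructor obstruction₄
  field
    a b c e : Fin n
    a<b : a F.< b
    b<c : b F.< c
    c<e : c F.< e
    γ : Fin d
    o : Orientation
    b<e : M γ b <[ o ] M γ e
    e<a : M γ e <[ o ] M γ a
    a<c : M γ a <[ o ] M γ c

Obstruction : ∀ {d n} → Mat d n → Set
Obstruction M = Obstruction₃ M ⊎ Obstruction₄ M

obstruction-transfer : ∀ {d n n'} {M' : Mat d n'} {M : Mat d n} (f : Fin n' → Fin n) →
  (∀ {a b} → a F.< b → f a F.< f b) → (∀ i → OrderPreserving (M' i) (λ j → M i (f j))) →
  Obstruction M' → Obstruction M
obstruction-transfer {M' = M'} {M} f f-mono preserves
  (inj₁ (obstruction₃ p q z p<q q<z α β α-between β-between)) =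
  inj₁ (obstruction₃ (f p) (f q) (f z) (f-mono p<q) (f-mono q<z) α β
         (transfer α α-between) (transfer β β-between))
  where
  transfer : ∀ i {x y w} → Between (M' i x) (M' i y) (M' i w) →
    Between (M i (f x)) (M i (f y)) (M i (f w))
  transfer i (inj₁ (x<y , y<w)) = inj₁ (preserves i x<y , preserves i y<w)
  transfer i (inj₂ (w<y , y<x)) = inj₂ (preserves i w<y , preserves i y<x)
obstruction-transfer {M' = M'} f f-mono preserves
  (inj₂ (obstruction₄ a b c e a<b b<c c<e γ o b<e e<a a<c)) =
  inj₂ (obstruction₄ (f a) (f b) (f c) (f e) (f-mono a<b) (f-mono b<c) (f-mono c<e) γ o
         (transfer b<e) (transfer e<a) (transfer a<c))
  where
  transfer = OrderPreserving-<[] {f = M' γ} (preserves γ) o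

inject₁-mono-< : ∀ {n} {a b : Fin n} → a F.< b → inject₁ a F.< inject₁ b
inject₁-mono-< {a = a} {b} = subst₂ _<_ (sym (toℕ-inject₁ a)) (sym (toℕ-inject₁ b))

↑ˡ-mono-< : ∀ {m} n {a b : Fin m} → a F.< b → (a ↑ˡ n) F.< (b ↑ˡ n)
↑ˡ-mono-< n {a} {b} = subst₂ _<_ (sym (toℕ-↑ˡ a n)) (sym (toℕ-↑ˡ b n))

↑ʳ-mono-< : ∀ {m} n {a b : Fin m} → a F.< b → (n ↑ʳ a) F.< (n ↑ʳ b)
↑ʳ-mono-< n {a} {b} a<b = subst₂ _<_ (sym (toℕ-↑ʳ n a)) (sym (toℕ-↑ʳ n b)) (+-monoʳ-< n a<b)

least : ∀ {P : ℕ → Set} → (∀ k → Dec (P k)) → ∀ {k} → P k →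
  ∃[ m ] m ≤ k × P m × (∀ {j} → j < m → ¬ P j)
least {P} P? {k} = <-rec Goal step k
  where
  Goal : ℕ → Set
  Goal k = P k → ∃[ m ] m ≤ k × P m × (∀ {j} → j < m → ¬ P j)
  step : ∀ k → (∀ {j} → j < k → Goal j) → Goal k
  step k rec Pk with anyUpTo? P? k
  ... | yes (j , j<k , Pj) =
    let (m , m≤j , Pm , below) = rec j<k Pj in m , ≤-trans m≤j (<⇒≤ j<k) , Pm , below
  ... | no none = k , ≤-refl , Pk , λ j<k Pj → none (_ , j<k , Pj)

restrict : ∀ {d N} → Mat d (suc N) → Mat d N
restrict M i j = M i (inject₁ j)

restrict-injective : ∀ {d N} {M : Mat d (suc N)} → RowInjective M → RowInjective (restrict M)
restrict-injective inj i eq = inject₁-injective (inj i eq)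

lower : ∀ {N} (x : Fin (suc N)) → toℕ x < N → ∃[ y ] inject₁ y ≡ x
lower x x<N = lower₁ x (>⇒≢ x<N) , inject₁-lower₁ x (>⇒≢ x<N)

restricted-crossing : ∀ {d N} {M : Mat d (suc N)} {γ ℓ o} → RowCut (restrict M) γ ℓ o →
  ∀ {a b} → toℕ a < ℓ → ℓ ≤ toℕ b → toℕ b < N → M γ a <[ o ] M γ b
restricted-crossing {ℓ = ℓ} cut {a} {b} a<ℓ ℓ≤b b<N
  with lower a (<-≤-trans a<ℓ (≤-trans ℓ≤b (<⇒≤ b<N))) | lower b b<N
... | a' , refl | b' , refl =
  cut a' b' (subst (_< ℓ) (toℕ-inject₁ a') a<ℓ) (subst (ℓ ≤_) (toℕ-inject₁ b') ℓ≤b)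

-- The first N columns of M have their least proper cut at m, each row γ cutting there in
-- orientation `orient γ`, while M itself is cut neither at m nor at N.  In `_≺[_]_`
-- columns are compared in the orientation of the row, so that the first m columns precede
-- the columns m … N-1 in every row.
module MinimalCut {d N} (M : Mat d (suc N)) (inj : RowInjective M) {m} (m<N : m < N)
  (orient : Fin d → Orientation)
  (crossing : ∀ γ {a b} → toℕ a < m → m ≤ toℕ b → toℕ b < N → M γ a <[ orient γ ] M γ b)
  (minimal : ∀ {ℓ} → 1 ≤ ℓ → ℓ < m → ¬ CutAt (restrict M) ℓ)
  (¬cutₘ : ¬ CutAt M m) (¬cutₙ : ¬ CutAt M N) where

  _≺[_]_ : Fin (suc N) → Fin d → Fin (suc N) → Set
  a ≺[ γ ] b = M γ a <[ orient γ ] M γ b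

  _≺[_]?_ : ∀ a γ b → Dec (a ≺[ γ ] b)
  a ≺[ γ ]? b = M γ a <[ orient γ ]? M γ b

  ≺-trans : ∀ γ {a b c} → a ≺[ γ ] b → b ≺[ γ ] c → a ≺[ γ ] c
  ≺-trans γ = <[]-trans (orient γ)

  ≺-asym : ∀ γ {a b} → a ≺[ γ ] b → ¬ b ≺[ γ ] a
  ≺-asym γ = <[]-asym (orient γ)

  ≺-connex : ∀ γ {a b} → a ≢ b → a ≺[ γ ] b ⊎ b ≺[ γ ] a
  ≺-connex γ a≢b = <[]-connex (orient γ) (a≢b ∘ inj γ)

  ≢-by-toℕ : ∀ {a b : Fin (suc N)} → toℕ a < toℕ b → a ≢ b
  ≢-by-toℕ a<b refl = <-irrefl refl a<b

  last : Fin (suc N)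
  last = fromℕ N

  columnₘ : Fin (suc N)
  columnₘ = fromℕ< (m≤n⇒m≤1+n m<N)

  toℕ-columnₘ : toℕ columnₘ ≡ m
  toℕ-columnₘ = toℕ-fromℕ< (m≤n⇒m≤1+n m<N)

  m≤columnₘ : m ≤ toℕ columnₘ
  m≤columnₘ = ≤-reflexive (sym toℕ-columnₘ)

  columnₘ<N : toℕ columnₘ < N
  columnₘ<N = subst (_< N) (sym toℕ-columnₘ) m<N

  is-last : ∀ x → N ≤ toℕ x → x ≡ last
  is-last x N≤x = toℕ-injective (trans (≤-antisym (s≤s⁻¹ (toℕ<n x)) N≤x) (sym (toℕ-fromℕ N)))

  <-last : ∀ {x : Fin (suc N)} → toℕ x < N → x F.< last
  <-last {x} x<N = subst (toℕ x <_) (sym (toℕ-fromℕ N)) x<N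

  <-columnₘ : ∀ {x : Fin (suc N)} → toℕ x < m → x F.< columnₘ
  <-columnₘ {x} x<m = subst (toℕ x <_) (sym toℕ-columnₘ) x<m

  ≺-columnₘ : ∀ γ {a} → toℕ a < m → a ≺[ γ ] columnₘ
  ≺-columnₘ γ a<m = crossing γ a<m m≤columnₘ columnₘ<N

  ≺-connex-last : ∀ γ {x} → toℕ x < N → x ≺[ γ ] last ⊎ last ≺[ γ ] x
  ≺-connex-last γ x<N = ≺-connex γ (≢-by-toℕ (<-last x<N))

  Inversion : Fin d → Fin (suc N) → Fin (suc N) → Set
  Inversion γ a b = toℕ a < toℕ b × b ≺[ γ ] a

  inversion-across : ∀ {ℓ} → 1 ≤ ℓ → ℓ < m →
    ∃[ γ ] ∃₂ λ a b → toℕ a < ℓ × ℓ ≤ toℕ b × toℕ b < m × b ≺[ γ ] a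
  inversion-across {ℓ} 1≤ℓ ℓ<m with ¬cutAt⇒¬rowCut (minimal 1≤ℓ ℓ<m)
  ... | γ , ¬rowCut with ¬rowCut⇒inversion (restrict-injective inj) (¬rowCut (orient γ))
  ... | j , j' , j<ℓ , ℓ≤j' , j'≺j with m ≤? toℕ (inject₁ j')
  ... | yes m≤j' = contradiction j'≺j (≺-asym γ (crossing γ j<m m≤j' (inject₁ℕ< j')))
    where j<m = subst (_< m) (sym (toℕ-inject₁ j)) (<-trans j<ℓ ℓ<m)
  ... | no m≰j' = γ , inject₁ j , inject₁ j' , subst (_< ℓ) (sym (toℕ-inject₁ j)) j<ℓ ,
                  subst (ℓ ≤_) (sym (toℕ-inject₁ j')) ℓ≤j' , ≰⇒> m≰j' , j'≺j

  Edge : (Fin (suc N) → Set) → Set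
  Edge S = ∃₂ λ w w' → S w × ¬ S w' × toℕ w < m × toℕ w' < m ×
           ∃[ γ ] (Inversion γ w w' ⊎ Inversion γ w' w)

  -- Take the least column x ∉ S; the inversion across position x that minimality provides
  -- leaves S, possibly after one comparison with x.
  connected-from-0 : ∀ {S} → Decidable S → S 0F → ∀ {y} → ¬ S y → toℕ y < m → Edge S
  connected-from-0 {S} S? S0 {y} ¬Sy y<m
    with least (λ j → any? λ x → (toℕ x ≟ j) ×-dec ¬? (S? x)) (y , refl , ¬Sy)
  ... | _ , x≤y , (x , refl , ¬Sx) , smallest = edge-at x ¬Sx (≤-<-trans x≤y y<m) before-x
    where
    before-x : ∀ {a} → toℕ a < toℕ x → S a
    before-x {a} a<x = decidable-stable (S? a) λ ¬Sa → smallest a<x (a , refl , ¬Sa)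
    edge-at : ∀ x → ¬ S x → toℕ x < m → (∀ {a} → toℕ a < toℕ x → S a) → Edge S
    edge-at F.zero ¬S0 _ _ = contradiction S0 ¬S0
    edge-at x@(F.suc _) ¬Sx x<m inS with inversion-across (s≤s z≤n) x<m
    ... | γ , a , b , a<x , x≤b , b<m , b≺a with S? b
    ... | no ¬Sb = a , b , inS a<x , ¬Sb , <-trans a<x x<m , b<m , γ , inj₁ (<-≤-trans a<x x≤b , b≺a)
    ... | yes Sb with ≺-connex γ (≢-by-toℕ a<x ∘ sym)
    ...   | inj₁ x≺a = a , x , inS a<x , ¬Sx , <-trans a<x x<m , x<m , γ , inj₁ (a<x , x≺a)
    ...   | inj₂ a≺x = b , x , Sb , ¬Sx , b<m , x<m , γ , inj₂ (x<b , ≺-trans γ b≺a a≺x)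
      where x<b = ≤∧≢⇒< x≤b (λ x≡b → ¬Sx (subst S (toℕ-injective (sym x≡b)) Sb))

  connected : ∀ {S} → Decidable S → ∀ {x y} → S x → ¬ S y → toℕ x < m → toℕ y < m → Edge S
  connected {S} S? Sx ¬Sy x<m y<m with S? 0F
  ... | yes S0 = connected-from-0 S? S0 ¬Sy y<m
  ... | no ¬S0 with connected-from-0 (¬? ∘ S?) ¬S0 (λ ¬Sx → ¬Sx Sx) x<m
  ...   | w , w' , ¬Sw , ¬¬Sw' , w<m , w'<m , γ , inversion =
          w' , w , decidable-stable (S? w') ¬¬Sw' , ¬Sw , w'<m , w<m , γ , swap inversion

  last-precedes-prefix : ∃₂ λ s u → toℕ u < m × last ≺[ s ] u
  last-precedes-prefix with ¬cutAt⇒¬rowCut ¬cutₘ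
  ... | s , ¬rowCut with ¬rowCut⇒inversion inj (¬rowCut (orient s))
  ... | u , j , u<m , m≤j , j≺u with toℕ j <? N
  ... | yes j<N = contradiction j≺u (≺-asym s (crossing s u<m m≤j j<N))
  ... | no  j≮N = s , u , u<m , subst (_≺[ s ] u) (is-last j (≮⇒≥ j≮N)) j≺u

  last-interior : ∃[ r ] ∃₂ λ x y → toℕ x < N × toℕ y < N × last ≺[ r ] x × y ≺[ r ] last
  last-interior with ¬cutAt⇒¬rowCut ¬cutₙ
  ... | r , ¬rowCut with ¬rowCut⇒inversion inj (¬rowCut (orient r))
                       | ¬rowCut⇒inversion inj (¬rowCut (reverse (orient r)))
  ... | x , j , x<N , N≤j , j≺x | y , j' , y<N , N≤j' , j'≻y =
    r , x , y , x<N , y<N , subst (_≺[ r ] x) (is-last j N≤j) j≺x ,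
    subst (y ≺[ r ]_) (is-last j' N≤j') (<[]-reverse (orient r) j'≻y)

  LastPrecedes : Fin (suc N) → Set
  LastPrecedes x = ∃[ α ] last ≺[ α ] x

  ≺last : ∀ {x} → toℕ x < m → ¬ LastPrecedes x → ∀ i → x ≺[ i ] last
  ≺last x<m ¬last≺x i = [ id , (λ last≺x → contradiction (i , last≺x) ¬last≺x) ]′
                          (≺-connex-last i (<-trans x<m m<N))

  obstruction-across-m : ∀ s r {u v} → toℕ u < m → m ≤ toℕ v → toℕ v < N →
    last ≺[ s ] u → u ≺[ r ] last → last ≺[ r ] v → Obstruction M
  obstruction-across-m s r u<m m≤v v<N last≺u u≺last last≺v =
    inj₁ (obstruction₃ _ _ last (<-≤-trans u<m m≤v) (<-last v<N) s r
           (Between-sym (between (orient s) last≺u (crossing s u<m m≤v v<N)))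
           (between (orient r) u≺last last≺v))

  edge⇒obstruction : Edge LastPrecedes → Obstruction M
  edge⇒obstruction (w , w' , (β , last≺w) , ¬last≺w' , w<m , w'<m , γ , inj₂ (w'<w , w≺w')) =
    inj₁ (obstruction₃ w' w last w'<w (<-last (<-trans w<m m<N)) γ β
           (between (orient γ) w≺w' (≺last w'<m ¬last≺w' γ))
           (between (orient β) (≺last w'<m ¬last≺w' β) last≺w))
  edge⇒obstruction (w , w' , (β , last≺w) , ¬last≺w' , w<m , w'<m , γ , inj₁ (w<w' , w'≺w))
    with ≺-connex-last γ (<-trans w<m m<N)
  ... | inj₁ w≺ᵞlast = inj₁ (obstruction₃ w w' last w<w' (<-last (<-trans w'<m m<N)) γ β
                              (between (orient γ) w'≺w w≺ᵞlast)
                              (Between-sym (between (orient β) (≺last w'<m ¬last≺w' β) last≺w)))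
  ... | inj₂ last≺ᵞw = inj₂ (obstruction₄ w w' columnₘ last w<w' (<-columnₘ w'<m) (<-last columnₘ<N)
                              γ (orient γ) (≺last w'<m ¬last≺w' γ) last≺ᵞw (≺-columnₘ γ w<m))

  obstruction-last-first : ∀ s r {u y} → toℕ u < m → toℕ y < m →
    last ≺[ s ] u → last ≺[ r ] u → y ≺[ r ] last → Obstruction M
  obstruction-last-first s r u<m y<m last≺ˢu last≺ʳu y≺last with any? (λ α → last ≺[ α ]? _)
  ... | yes (α , last≺y) = obstruction-across-m α r y<m m≤columnₘ columnₘ<N last≺y y≺last
                             (≺-trans r last≺ʳu (≺-columnₘ r u<m))
  ... | no ¬last≺y = edge⇒obstruction
                       (connected (λ x → any? (λ α → last ≺[ α ]? x)) (s , last≺ˢu) ¬last≺y u<m y<m)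

  obstruction : Obstruction M
  obstruction with last-precedes-prefix | last-interior
  ... | s , u , u<m , last≺ˢu | r , x , y , x<N , y<N , last≺x , y≺last
    with ≺-connex-last r (<-trans u<m m<N)
  ... | inj₁ u≺last with m ≤? toℕ x
  ...   | yes m≤x = obstruction-across-m s r u<m m≤x x<N last≺ˢu u≺last last≺x
  ...   | no  m≰x = obstruction-across-m s r u<m m≤columnₘ columnₘ<N last≺ˢu u≺last
                      (≺-trans r last≺x (≺-columnₘ r (≰⇒> m≰x)))
  obstruction | s , u , u<m , last≺ˢu | r , x , y , x<N , y<N , last≺x , y≺last | inj₂ last≺ʳu =
    obstruction-last-first s r u<m y<m last≺ˢu last≺ʳu y≺last
    where
    y<m : toℕ y < m
    y<m = ≰⇒> λ m≤y → ≺-asym r y≺last (≺-trans r last≺ʳu (crossing r u<m m≤y y<N))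

two-column-cut : ∀ {d} (M : Mat d 2) → RowInjective M → CutAt M 1
two-column-cut M inj i =
  [ (λ lt → ascending , crossing ascending lt) , (λ gt → descending , crossing descending gt) ]′
    (<[]-connex ascending {M i 0F} {M i 1F} (λ eq → contradiction (inj i eq) λ ()))
  where
  crossing : ∀ o → M i 0F <[ o ] M i 1F → RowCut M i 1 o
  crossing _ lt 0F 1F _ _ = lt
  crossing _ lt 0F 0F _ ()
  crossing _ lt (F.suc _) _ (s≤s ()) _

cut-or-obstruction : ∀ {d} N (M : Mat d (suc N)) → 1 ≤ N → RowInjective M →
  ProperCut M ⊎ Obstruction M
cut-or-obstruction zero M () _
cut-or-obstruction 1 M _ inj = inj₁ (1 , ≤-refl , ≤-refl , two-column-cut M inj)
cut-or-obstruction (suc (suc K)) M _ inj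
  with cut-or-obstruction (suc K) (restrict M) (s≤s z≤n) (restrict-injective inj)
... | inj₂ obstructed = inj₂ (obstruction-transfer inject₁ inject₁-mono-< (λ _ → id) obstructed)
... | inj₁ (ℓ₀ , 1≤ℓ₀ , ℓ₀<N , cut₀)
  with least (λ ℓ → (1 ≤? ℓ) ×-dec cutAt? (restrict M) ℓ) (1≤ℓ₀ , cut₀)
...   | m , m≤ℓ₀ , (1≤m , cutₘ) , below-m with cutAt? M m | cutAt? M (suc (suc K))
...     | yes cut | _ = inj₁ (m , 1≤m , m<n⇒m<1+n (≤-<-trans m≤ℓ₀ ℓ₀<N) , cut)
...     | no _ | yes cut = inj₁ (suc (suc K) , s≤s z≤n , ≤-refl , cut)
...     | no ¬cutₘ | no ¬cutₙ = inj₂ (MinimalCut.obstruction M inj (≤-<-trans m≤ℓ₀ ℓ₀<N)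
          (proj₁ ∘ cutₘ) (λ γ → restricted-crossing {M = M} (proj₂ (cutₘ γ)))
          (λ 1≤ℓ ℓ<m cut → below-m ℓ<m (1≤ℓ , cut)) ¬cutₘ ¬cutₙ)

data Split : ℕ → ℕ → Set where
  split : ∀ l r → Split (suc l + suc r) (suc l)

split-at : ∀ {ℓ n} → 1 ≤ ℓ → ℓ < n → Split n ℓ
split-at {suc l} {n} _ ℓ<n with n ∸ suc (suc l) | m+[n∸m]≡n ℓ<n
... | k | refl = subst (λ n → Split n (suc l)) (cong suc (+-suc l k)) (split l k)

cut⇒splitOK : ∀ {d l r} (M : Mat d (suc l + suc r)) → CutAt M (suc l) → SplitOK M
cut⇒splitOK {l = l} {r} M cut i = oriented (cut i)
  where
  crossing : ∀ o → RowCut M i (suc l) o → ∀ j₁ j₂ → leftPart M i j₁ <[ o ] rightPart M i j₂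
  crossing _ rowCut j₁ j₂ = rowCut (j₁ ↑ˡ suc r) (suc l ↑ʳ j₂)
    (subst (_< suc l) (sym (toℕ-↑ˡ j₁ (suc r))) (toℕ<n j₁))
    (subst (suc l ≤_) (sym (toℕ-↑ʳ (suc l) j₂)) (m≤m+n (suc l) (toℕ j₂)))
  oriented : ∃ (RowCut M i (suc l)) → _
  oriented (ascending  , rowCut) = inj₁ (crossing ascending rowCut)
  oriented (descending , rowCut) = inj₂ (crossing descending rowCut)

unobstructed⇒separable : ∀ {d} n (M : Mat d n) → 1 ≤ n → RowInjective M → ¬ Obstruction M →
  Separable n M
unobstructed⇒separable {d} = <-rec Goal step
  where
  Goal : ℕ → Set
  Goal n = (M : Mat d n) → 1 ≤ n → RowInjective M → ¬ Obstruction M → Separable n M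

  block : ∀ {n m} → (∀ {k} → k < n → Goal k) → (M : Mat d n) → RowInjective M → ¬ Obstruction M →
    (f : Fin m → Fin n) → Injective _≡_ _≡_ f → (∀ {a b} → a F.< b → f a F.< f b) → 1 ≤ m → m < n →
    Separable m (relabel (λ i j → M i (f j)))
  block rec M inj unobstructed f f-injective f-mono 1≤m m<n =
    rec m<n _ 1≤m (relabel-injective (λ i → f-injective ∘ inj i))
        (unobstructed ∘ obstruction-transfer f f-mono (relabel-cancel-< _))

  at-split : ∀ {n ℓ} → Split n ℓ → (∀ {k} → k < n → Goal k) →
    (M : Mat d n) → CutAt M ℓ → RowInjective M → ¬ Obstruction M → Separable n M
  at-split (split l r) rec M cut inj unobstructed = sep-split M (cut⇒splitOK M cut)
    (block rec M inj unobstructed (_↑ˡ suc r) (↑ˡ-injective (suc r) _ _) (↑ˡ-mono-< (suc r))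
           (s≤s z≤n) (m<m+n (suc l) z<s))
    (block rec M inj unobstructed (suc l ↑ʳ_) (↑ʳ-injective (suc l) _ _) (↑ʳ-mono-< (suc l))
           (s≤s z≤n) (m<n+m (suc r) z<s))

  step : ∀ n → (∀ {k} → k < n → Goal k) → Goal n
  step zero _ _ () _ _
  step 1 _ M _ _ _ = sep-one M
  step (suc (suc k)) rec M _ inj unobstructed with cut-or-obstruction (suc k) M (s≤s z≤n) inj
  ... | inj₂ obstructed = contradiction obstructed unobstructed
  ... | inj₁ (ℓ , 1≤ℓ , ℓ<n , cut) = at-split (split-at 1≤ℓ ℓ<n) rec M cut inj unobstructed

-- Obstructions are occurrences of the patterns

increasing-from-consecutive : ∀ {k} (g : Fin (suc k) → ℕ) → (∀ i → g (inject₁ i) < g (F.suc i)) →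
  ∀ {a b} → a F.< b → g a < g b
increasing-from-consecutive {suc k} g step {F.zero} {F.suc F.zero} _ = step F.zero
increasing-from-consecutive {suc k} g step {F.zero} {F.suc (F.suc b)} _ =
  <-trans (step F.zero) (increasing-from-consecutive (g ∘ F.suc) (step ∘ F.suc) {F.zero} {F.suc b} z<s)
increasing-from-consecutive {suc k} g step {F.suc a} {F.suc b} (s<s a<b) =
  increasing-from-consecutive (g ∘ F.suc) (step ∘ F.suc) a<b

record Ranked {k} (q : Fin k → ℕ) (ks : Vec (Fin k) k) : Set where
  constructor ranked
  field
    ranks : ∀ i → q (lookup ks i) ≡ toℕ i
    onto  : ∀ a → ∃[ i ] lookup ks i ≡ a

ranked? : ∀ {k} (q : Fin k → ℕ) ks → Dec (Ranked q ks)
ranked? q ks = map′ (λ (r , o) → ranked r o) (λ (ranked r o) → r , o)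
  (all? (λ i → q (lookup ks i) ≟ toℕ i) ×-dec all? (λ a → any? λ i → lookup ks i F.≟ a))

Ranked⇒injective : ∀ {k} {q : Fin k → ℕ} {ks} → Ranked q ks → Injective _≡_ _≡_ q
Ranked⇒injective {ks = ks} (ranked ranks onto) {a} {b} qa≡qb with onto a | onto b
... | i , refl | i' , refl =
  cong (lookup ks) (toℕ-injective (trans (sym (ranks i)) (trans qa≡qb (ranks i'))))

Ranked⇒preserving : ∀ {k} {q : Fin (suc k) → ℕ} {ks} → Ranked q ks → ∀ {f : Fin (suc k) → ℕ} →
  (∀ i → f (lookup ks (inject₁ i)) < f (lookup ks (F.suc i))) → OrderPreserving q f
Ranked⇒preserving {ks = ks} (ranked ranks onto) {f} steps {a} {b} qa<qb with onto a | onto b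
... | i , refl | i' , refl =
  increasing-from-consecutive (f ∘ lookup ks) steps (subst₂ _<_ (ranks i) (ranks i') qa<qb)

reindex : ∀ {d k} → Mat d k → Permutation′ k → Mat d k
reindex Q σ t j = Q t (σ ⟨$⟩ˡ j)

RowsDistinct : ∀ {d k} → Mat d k → Set
RowsDistinct {d} {k} Q = ∀ t t' → t ≢ t' → ∃₂ λ (a b : Fin k) → Q t a < Q t b × Q t' b < Q t' a

rowsDistinct? : ∀ {d k} (Q : Mat d k) → Dec (RowsDistinct Q)
rowsDistinct? Q = all? λ t → all? λ t' → ¬? (t F.≟ t') →-dec
  any? λ a → any? λ b → (Q t a <? Q t b) ×-dec (Q t' b <? Q t' a)

-- σ sends the columns of Q to positions of an occurrence, and ks t lists these positions
-- in increasing order of row t; everything here is checked by evaluation.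
record Template {d k} (Q : Mat d k) (σ : Permutation′ k) (ks : Fin d → Vec (Fin k) k) : Set where
  constructor template
  field
    rankings : ∀ t → Ranked (reindex Q σ t) (ks t)
    counts   : ∀ t j → countBelow (reindex Q σ t) (Q t j) ≡ Q t j
    distinct : RowsDistinct (reindex Q σ)

template? : ∀ {d k} (Q : Mat d k) σ ks → Dec (Template Q σ ks)
template? Q σ ks = map′ (λ (r , c , d) → template r c d) (λ (template r c d) → r , c , d)
  (all? (λ t → ranked? (reindex Q σ t) (ks t)) ×-dec
   all? (λ t → all? λ j → countBelow (reindex Q σ t) (Q t j) ≟ Q t j) ×-dec
   rowsDistinct? (reindex Q σ))

contains-by-ranking : ∀ {d n d' k} (Q : Mat d' (suc k)) (σ : Permutation′ (suc k)) ks →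
  {checked : True (template? Q σ ks)} →
  (P : Mat d n) (ι : Fin d' → Fin d) (c : Fin (suc k) → Fin n) → (∀ i → c (inject₁ i) F.< c (F.suc i)) →
  (∀ t i → P (ι t) (c (lookup (ks t) (inject₁ i))) < P (ι t) (c (lookup (ks t) (F.suc i)))) →
  Contains P Q
contains-by-ranking {d' = d'} {k} Q σ ks {checked} P ι c c-steps row-steps =
  ι , ι-injective , c , increasing-from-consecutive (toℕ ∘ c) c-steps , σ , relabelled
  where
  open Template (toWitness checked)

  row : Fin d' → Fin (suc k) → ℕ
  row t j = P (ι t) (c j)

  preserves : ∀ t → OrderPreserving (reindex Q σ t) (row t)
  preserves t = Ranked⇒preserving (rankings t) (row-steps t)

  -- Distinct rows of Q order the columns differently, so they cannot come from one row of P.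
  ι-injective : Injective _≡_ _≡_ ι
  ι-injective {t} {t'} ιt≡ιt' with t F.≟ t'
  ... | yes t≡t' = t≡t'
  ... | no  t≢t' with distinct t t' t≢t'
  ...   | a , b , a<ᵗb , b<ᵗ'a =
    contradiction (subst (λ i → P i (c a) < P i (c b)) ιt≡ιt' (preserves t a<ᵗb)) (<-asym (preserves t' b<ᵗ'a))

  relabelled : ∀ t j → relabel row t (σ ⟨$⟩ʳ j) ≡ Q t j
  relabelled t j = begin
    countBelow (row t) (row t (σ ⟨$⟩ʳ j))
      ≡⟨ countBelow-cong (row t) (reindex Q σ t)
           (λ _ → OrderPreserving-reflects (preserves t) (Ranked⇒injective (rankings t)))
           (λ _ → preserves t) ⟩
    countBelow (reindex Q σ t) (Q t (σ ⟨$⟩ˡ (σ ⟨$⟩ʳ j)))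
      ≡⟨ cong (countBelow (reindex Q σ t) ∘ Q t) (inverseˡ σ) ⟩
    countBelow (reindex Q σ t) (Q t j)
      ≡⟨ counts t j ⟩
    Q t j ∎
    where open ≡-Reasoning

module _ {d n} (P : Mat (suc d) n) (increasing : ∀ {a b} → a F.< b → P 0F a < P 0F b) where

  obstruction₃⇒contains : Obstruction₃ P → Contains P π₂ ⊎ Contains P π₃
  obstruction₃⇒contains (obstruction₃ p q z p<q q<z α β (inj₁ (q<ᵅp , p<ᵅz)) (inj₁ (p<ᵝz , z<ᵝq))) =
    inj₁ (contains-by-ranking π₂ Perm.id
      (λ { 0F → 0F ∷ 1F ∷ 2F ∷ [] ; 1F → 1F ∷ 0F ∷ 2F ∷ [] ; 2F → 0F ∷ 2F ∷ 1F ∷ [] })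
      P (lookup (0F ∷ α ∷ β ∷ [])) (lookup (p ∷ q ∷ z ∷ [])) (λ { 0F → p<q ; 1F → q<z })
      λ { 0F 0F → increasing p<q ; 0F 1F → increasing q<z
        ; 1F 0F → q<ᵅp ; 1F 1F → p<ᵅz
        ; 2F 0F → p<ᵝz ; 2F 1F → z<ᵝq })
  obstruction₃⇒contains (obstruction₃ p q z p<q q<z α β (inj₂ (z<ᵅp , p<ᵅq)) (inj₂ (q<ᵝz , z<ᵝp))) =
    inj₂ (contains-by-ranking π₃ Perm.id
      (λ { 0F → 0F ∷ 1F ∷ 2F ∷ [] ; 1F → 2F ∷ 0F ∷ 1F ∷ [] ; 2F → 1F ∷ 2F ∷ 0F ∷ [] })
      P (lookup (0F ∷ α ∷ β ∷ [])) (lookup (p ∷ q ∷ z ∷ [])) (λ { 0F → p<q ; 1F → q<z })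
      λ { 0F 0F → increasing p<q ; 0F 1F → increasing q<z
        ; 1F 0F → z<ᵅp ; 1F 1F → p<ᵅq
        ; 2F 0F → q<ᵝz ; 2F 1F → z<ᵝp })
  obstruction₃⇒contains (obstruction₃ p q z p<q q<z α β (inj₁ (q<ᵅp , p<ᵅz)) (inj₂ (q<ᵝz , z<ᵝp))) =
    inj₁ (contains-by-ranking π₂ (transpose 0F 1F)
      (λ { 0F → 1F ∷ 0F ∷ 2F ∷ [] ; 1F → 0F ∷ 1F ∷ 2F ∷ [] ; 2F → 1F ∷ 2F ∷ 0F ∷ [] })
      P (lookup (α ∷ 0F ∷ β ∷ [])) (lookup (p ∷ q ∷ z ∷ [])) (λ { 0F → p<q ; 1F → q<z })
      λ { 0F 0F → q<ᵅp ; 0F 1F → p<ᵅz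
        ; 1F 0F → increasing p<q ; 1F 1F → increasing q<z
        ; 2F 0F → q<ᵝz ; 2F 1F → z<ᵝp })
  obstruction₃⇒contains (obstruction₃ p q z p<q q<z α β (inj₂ (z<ᵅp , p<ᵅq)) (inj₁ (p<ᵝz , z<ᵝq))) =
    inj₁ (contains-by-ranking π₂ (transpose 1F 2F)
      (λ { 0F → 0F ∷ 2F ∷ 1F ∷ [] ; 1F → 2F ∷ 0F ∷ 1F ∷ [] ; 2F → 0F ∷ 1F ∷ 2F ∷ [] })
      P (lookup (β ∷ α ∷ 0F ∷ [])) (lookup (p ∷ q ∷ z ∷ [])) (λ { 0F → p<q ; 1F → q<z })
      λ { 0F 0F → p<ᵝz ; 0F 1F → z<ᵝq
        ; 1F 0F → z<ᵅp ; 1F 1F → p<ᵅq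
        ; 2F 0F → increasing p<q ; 2F 1F → increasing q<z })

  obstruction₄⇒contains : Obstruction₄ P → Contains P π₁
  obstruction₄⇒contains (obstruction₄ a b c e a<b b<c c<e γ descending e<b a<e c<a) =
    contains-by-ranking π₁ Perm.id
      (λ { 0F → 0F ∷ 1F ∷ 2F ∷ 3F ∷ [] ; 1F → 2F ∷ 0F ∷ 3F ∷ 1F ∷ [] })
      P (lookup (0F ∷ γ ∷ [])) (lookup (a ∷ b ∷ c ∷ e ∷ [])) (λ { 0F → a<b ; 1F → b<c ; 2F → c<e })
      λ { 0F 0F → increasing a<b ; 0F 1F → increasing b<c ; 0F 2F → increasing c<e
        ; 1F 0F → c<a ; 1F 1F → a<e ; 1F 2F → e<b }
  obstruction₄⇒contains (obstruction₄ a b c e a<b b<c c<e γ ascending b<e e<a a<c) =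
    contains-by-ranking π₁ σ
      (λ { 0F → 1F ∷ 3F ∷ 0F ∷ 2F ∷ [] ; 1F → 0F ∷ 1F ∷ 2F ∷ 3F ∷ [] })
      P (lookup (γ ∷ 0F ∷ [])) (lookup (a ∷ b ∷ c ∷ e ∷ [])) (λ { 0F → a<b ; 1F → b<c ; 2F → c<e })
      λ { 0F 0F → b<e ; 0F 1F → e<a ; 0F 2F → a<c
        ; 1F 0F → increasing a<b ; 1F 1F → increasing b<c ; 1F 2F → increasing c<e }
    where
    forward backward : Vec (Fin 4) 4
    forward  = 1F ∷ 3F ∷ 0F ∷ 2F ∷ []
    backward = 2F ∷ 0F ∷ 3F ∷ 1F ∷ []
    σ : Permutation′ 4
    σ = permutation (lookup forward) (lookup backward)
          (from-yes (all? λ j → lookup forward (lookup backward j) F.≟ j))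
          (from-yes (all? λ j → lookup backward (lookup forward j) F.≟ j))

mainTheorem2 : (d n : ℕ) → 1 ≤ d → 1 ≤ n → (P : Mat d n) → IsDPerm P →
    Separable n P ⇔ (Avoids P π₁ × Avoids P π₂ × Avoids P π₃)
mainTheorem2 zero    _ () _ _ _
mainTheorem2 (suc d) n _ 1≤n P isDPerm = mk⇔ avoids separable
  where
  open IsDPerm isDPerm
  increasing : ∀ {a b} → a F.< b → P 0F a < P 0F b
  increasing {a} {b} = subst₂ _<_ (sym (firstRow 0F refl a)) (sym (firstRow 0F refl b))

  avoids : Separable n P → Avoids P π₁ × Avoids P π₂ × Avoids P π₃
  avoids sep = separable⇒avoids π₁ π₁-indecomposable sep ,
               separable⇒avoids π₂ π₂-indecomposable sep ,
               separable⇒avoids π₃ π₃-indecomposable sep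

  separable : Avoids P π₁ × Avoids P π₂ × Avoids P π₃ → Separable n P
  separable (¬π₁ , ¬π₂ , ¬π₃) = unobstructed⇒separable n P 1≤n rowInj
    [ [ ¬π₂ , ¬π₃ ]′ ∘ obstruction₃⇒contains P increasing
    , ¬π₁ ∘ obstruction₄⇒contains P increasing ]′
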